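{- In the setting below, let $T_{\min}$ be an addition tree over $X$ of minimum cost. (1) If $z$ is a node of $T_{\min}$ with $z>0$, then $z$ is of the form $\lambda H$, $(1/3+\lambda)H$, or $(2/3+\lambda)H$. (2) If $z$ is an internal node of $T_{\min}$ with $z<0$, then $z$ is of the form $\lambda H$, $(-1/3+\lambda)H$, or $(-2/3+\lambda)H$.
   Context: Let $m,K$ be positive integers and $b_1,\ldots,b_{3m}$ positive integers with $K/4<b_i<K/2$ and $\sum_i b_i=mK$. Set $W=100(5m)^2K$, $a_i=b_i+W$, $L=3W+K$, $\varepsilon=1/(400(5m)^2)$, $h=\lfloor4\varepsilon L\rfloor$, $H=L+h$. Let $X$ be the multiset consisting of $a_1,\ldots,a_{3m}$, $m$ copies of $-H$ and $m$ copies of $h$. An addition tree over $X$ is a rooted full binary tree whose leaves are in bijection with the elements of $X$ (with multiplicity), labelled by them; a node's value is the sum of the labels of leaves in its subtree, and nodes are identified with their values. The cost is the sum of absolute values of internal nodes. Every node value $v$ of such a tree satisfies $|v/H-N/3|\le 1/(500m)$ for a unique integer $N$; we then say $v$ is of the form $(N/3+\lambda)H$ (with $|\lambda|\le 1/(500m)$); "of the form $\lambda H$" means $N=0$. -}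

module Defs where

open import Data.Nat as ℕ using (ℕ; zero; suc)
open import Data.Integer as ℤ using (ℤ; +_; -_; _+_; _-_; _*_; ∣_∣)
open import Data.Fin using (Fin)
open import Data.List.Relation.Binary.Permutation.Propositional using (_↭_)
open import Data.List using (List; []; _∷_; _++_; map; tabulate; replicate)

data Tree : Set where
  leaf : ℤ → Tree
  node : Tree → Tree → Tree

leaves : Tree → List ℤ
leaves (leaf x)   = x ∷ []
leaves (node l r) = leaves l ++ leaves r

value : Tree → ℤ
value (leaf x)   = x
value (node l r) = value l + value r

nodes : Tree → List ℤ
nodes (leaf x)       = x ∷ []
nodes t@(node l r)   = value t ∷ (nodes l ++ nodes r)

internalNodes : Tree → List ℤ
internalNodes (leaf x)     = []
internalNodes t@(node l r) = value t ∷ (internalNodes l ++ internalNodes r)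

cost : Tree → ℕ
cost (leaf x)       = 0
cost t@(node l r)   = ∣ value t ∣ ℕ.+ cost l ℕ.+ cost r

-- floor division; the divisor-0 case is never used (m ≥ 1 in the statement)
_div_ : ℕ → ℕ → ℕ
n div zero    = 0
n div (suc d) = n ℕ./ suc d

module Setting (m K : ℕ) (b : Fin (3 ℕ.* m) → ℕ) where

  Wₙ : ℕ
  Wₙ = 100 ℕ.* ((5 ℕ.* m) ℕ.* (5 ℕ.* m)) ℕ.* K

  aₙ : Fin (3 ℕ.* m) → ℕ
  aₙ i = b i ℕ.+ Wₙ

  Lₙ : ℕ
  Lₙ = 3 ℕ.* Wₙ ℕ.+ K

  -- h = ⌊4 ε L⌋ with ε = 1/(400 (5m)²), i.e. ⌊4L / (400 (5m)²)⌋
  hₙ : ℕ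
  hₙ = (4 ℕ.* Lₙ) div (400 ℕ.* ((5 ℕ.* m) ℕ.* (5 ℕ.* m)))

  Hₙ : ℕ
  Hₙ = Lₙ ℕ.+ hₙ

  X : List ℤ
  X = tabulate (λ i → + aₙ i) ++ (replicate m (- (+ Hₙ)) ++ replicate m (+ hₙ))

  IsTreeOver : Tree → Set
  IsTreeOver t = leaves t ↭ X

  -- v is of the form (N/3 + λ)H with |λ| ≤ 1/(500 m), i.e.
  -- |v/H - N/3| ≤ 1/(500 m), cleared of the positive denominators 3·500m·H:
  -- |1500 m v - 500 m N H| ≤ 3 H
  OfForm : ℤ → ℤ → Set
  OfForm N v = ∣ (+ (1500 ℕ.* m)) * v - (+ (500 ℕ.* m)) * N * (+ Hₙ) ∣ ℕ.≤ 3 ℕ.* Hₙ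

{-# OPTIONS --safe #-}
-- Give the labels of X classes: -3 for -H, 0 for h and 1 for each aᵢ, and let N t be the sum of
-- the classes of the leaves of t. Then 3 · value t = N t · H + error t, where |error t| is at most
-- the total error E = 36mK of the labels, and 2E < H, 500mE ≤ 3H; so every node is of the form
-- (N/3 + λ)H with N = N t. The classes of X sum to 0, so N = 0 at the root. If an internal node
-- had |N| ≥ 3, take one, node x y, with |N| = M maximal. It is not the root, so it has a sibling w,
-- and elementary integer arithmetic gives |N y + N w| < M or |N x + N w| < M. As errors are below
-- H/2, rotating to x (y w), resp. y (x w), replaces the internal node x y by one of smaller absolute
-- value and lowers the cost, which is impossible. Hence internal nodes have |N| ≤ 2, and |error| < H
-- forces N ≥ 0 at positive nodes and N ≤ 0 at negative ones.
module Submission where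

open import Defs
open import Data.Nat as ℕ using (ℕ)
open import Data.Integer using (ℤ)
open import Data.Fin using (Fin)
open import Data.Product using (_×_; _,_; ∃; ∃₂)
open import Data.Sum as Sum using (_⊎_; inj₁; inj₂)
open import Data.Empty using (⊥; ⊥-elim)
open import Data.List using (List; []; _∷_; _++_; map; foldr; tabulate; replicate)
import Data.List.Properties as List
open import Data.List.Membership.Propositional using (_∈_)
open import Data.List.Relation.Binary.Permutation.Propositional using (_↭_; ↭-refl; ↭-sym; ↭-trans)
import Data.List.Relation.Binary.Permutation.Propositional.Properties as ↭
open import Data.Nat.ListAction using (sum)
import Data.Nat.ListAction.Properties as ℕSum
import Data.Nat.Properties as ℕP
import Data.Integer.Properties as ℤP
import Data.Nat.Tactic.RingSolver as ℕ-Solver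
open import Function using (_∘_)
open import Relation.Nullary using (¬_; yes; no)
open import Relation.Binary.PropositionalEquality

module ListSums where
  open import Data.Nat using (zero; suc; z≤n)
  open import Data.Integer using (+_; 0ℤ; _+_; _*_)
  import Data.Fin as Fin
  open import Data.List.Relation.Binary.Permutation.Propositional using (↭⇒↭ₛ)
  open import Data.List.Relation.Binary.Permutation.Setoid.Properties using (foldr-commMonoid)

  sumℤ : List ℤ → ℤ
  sumℤ = foldr _+_ 0ℤ

  sumℤ-++ : ∀ xs ys → sumℤ (xs ++ ys) ≡ sumℤ xs + sumℤ ys
  sumℤ-++ []       ys = sym (ℤP.+-identityˡ (sumℤ ys))
  sumℤ-++ (x ∷ xs) ys = trans (cong (_+_ x) (sumℤ-++ xs ys)) (sym (ℤP.+-assoc x (sumℤ xs) (sumℤ ys)))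

  sumℤ-↭ : ∀ {xs ys} → xs ↭ ys → sumℤ xs ≡ sumℤ ys
  sumℤ-↭ p = foldr-commMonoid (setoid ℤ) ℤP.+-0-isCommutativeMonoid (↭⇒↭ₛ p)

  private
    suc-* : ∀ n c → c + + n * c ≡ + suc n * c
    suc-* n c = begin
      c + + n * c       ≡⟨ cong (_+ + n * c) (ℤP.*-identityˡ c) ⟨
      + 1 * c + + n * c ≡⟨ ℤP.*-distribʳ-+ c (+ 1) (+ n) ⟨
      + suc n * c       ∎
      where open ≡-Reasoning

  sumℤ-replicate : ∀ n x → sumℤ (replicate n x) ≡ + n * x
  sumℤ-replicate zero    x = sym (ℤP.*-zeroˡ x)
  sumℤ-replicate (suc n) x = trans (cong (_+_ x) (sumℤ-replicate n x)) (suc-* n x)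

  sumℤ-tabulate-const : ∀ {n} (f : Fin n → ℤ) {c} → (∀ i → f i ≡ c) → sumℤ (tabulate f) ≡ + n * c
  sumℤ-tabulate-const {zero}  f {c} f≡c = sym (ℤP.*-zeroˡ c)
  sumℤ-tabulate-const {suc n} f {c} f≡c =
    trans (cong₂ _+_ (f≡c Fin.zero) (sumℤ-tabulate-const (f ∘ Fin.suc) (f≡c ∘ Fin.suc))) (suc-* n c)

  sum-replicate : ∀ n x → sum (replicate n x) ≡ n ℕ.* x
  sum-replicate zero    x = refl
  sum-replicate (suc n) x = cong (x ℕ.+_) (sum-replicate n x)

  sum-tabulate-≤ : ∀ {n} (f : Fin n → ℕ) {c} → (∀ i → f i ℕ.≤ c) → sum (tabulate f) ℕ.≤ n ℕ.* c
  sum-tabulate-≤ {zero}  f f≤c = z≤n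
  sum-tabulate-≤ {suc n} f f≤c = ℕP.+-mono-≤ (f≤c Fin.zero) (sum-tabulate-≤ (f ∘ Fin.suc) (f≤c ∘ Fin.suc))

module AdditionTrees where
  open import Data.Nat using (_⊔_)
  open import Data.Integer using (_+_; ∣_∣)
  open import Algebra.Properties.CommutativeSemigroup ℕP.+-commutativeSemigroup using (xy∙z≈xz∙y)
  open import Data.List.Membership.Propositional.Properties using (∈-++⁻)
  open import Data.List.Relation.Unary.Any using (here; there)

  infix 4 _⊑_ _Improves_

  data _⊑_ : Tree → Tree → Set where
    here  : ∀ {t} → t ⊑ t
    left  : ∀ {s l r} → s ⊑ l → s ⊑ node l r
    right : ∀ {s l r} → s ⊑ r → s ⊑ node l r

  ⊑-trans : ∀ {s t u} → s ⊑ t → t ⊑ u → s ⊑ u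
  ⊑-trans s⊑t here      = s⊑t
  ⊑-trans s⊑t (left q)  = left (⊑-trans s⊑t q)
  ⊑-trans s⊑t (right q) = right (⊑-trans s⊑t q)

  ∈nodes⇒⊑ : ∀ {z} t → z ∈ nodes t → ∃ λ s → s ⊑ t × value s ≡ z
  ∈nodes⇒⊑ (leaf x)   (here z≡x)  = leaf x , here , sym z≡x
  ∈nodes⇒⊑ (node l r) (here z≡v)  = node l r , here , sym z≡v
  ∈nodes⇒⊑ (node l r) (there z∈) with ∈-++⁻ (nodes l) z∈
  ... | inj₁ z∈l = let s , s⊑l , v≡z = ∈nodes⇒⊑ l z∈l in s , left s⊑l , v≡z
  ... | inj₂ z∈r = let s , s⊑r , v≡z = ∈nodes⇒⊑ r z∈r in s , right s⊑r , v≡z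

  ∈internalNodes⇒⊑ : ∀ {z} t → z ∈ internalNodes t →
                     ∃₂ λ l r → node l r ⊑ t × value (node l r) ≡ z
  ∈internalNodes⇒⊑ (node l r) (here z≡v) = l , r , here , sym z≡v
  ∈internalNodes⇒⊑ (node l r) (there z∈) with ∈-++⁻ (internalNodes l) z∈
  ... | inj₁ z∈l = let a , b , s⊑l , v≡z = ∈internalNodes⇒⊑ l z∈l in a , b , left s⊑l , v≡z
  ... | inj₂ z∈r = let a , b , s⊑r , v≡z = ∈internalNodes⇒⊑ r z∈r in a , b , right s⊑r , v≡z

  record _Improves_ (s′ s : Tree) : Set where
    field
      value-≡  : value s′ ≡ value s
      leaves-↭ : leaves s′ ↭ leaves s
      cost-<   : cost s′ ℕ.< cost s

  node-improvesˡ : ∀ {l′ l} r → l′ Improves l → node l′ r Improves node l r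
  node-improvesˡ {l′} {l} r imp = record
    { value-≡  = cong (_+ value r) value-≡
    ; leaves-↭ = ↭.++⁺ʳ (leaves r) leaves-↭
    ; cost-<   = begin-strict
        ∣ value l′ + value r ∣ ℕ.+ cost l′ ℕ.+ cost r
          ≡⟨ cong (λ v → ∣ v + value r ∣ ℕ.+ cost l′ ℕ.+ cost r) value-≡ ⟩
        ∣ value l + value r ∣ ℕ.+ cost l′ ℕ.+ cost r
          <⟨ ℕP.+-monoˡ-< (cost r) (ℕP.+-monoʳ-< ∣ value l + value r ∣ cost-<) ⟩
        ∣ value l + value r ∣ ℕ.+ cost l ℕ.+ cost r ∎
    }
    where open _Improves_ imp
          open ℕP.≤-Reasoning

  node-improvesʳ : ∀ {r′ r} l → r′ Improves r → node l r′ Improves node l r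
  node-improvesʳ {r′} {r} l imp = record
    { value-≡  = cong (value l +_) value-≡
    ; leaves-↭ = ↭.++⁺ˡ (leaves l) leaves-↭
    ; cost-<   = begin-strict
        ∣ value l + value r′ ∣ ℕ.+ cost l ℕ.+ cost r′
          ≡⟨ cong (λ v → ∣ value l + v ∣ ℕ.+ cost l ℕ.+ cost r′) value-≡ ⟩
        ∣ value l + value r ∣ ℕ.+ cost l ℕ.+ cost r′
          <⟨ ℕP.+-monoʳ-< (∣ value l + value r ∣ ℕ.+ cost l) cost-< ⟩
        ∣ value l + value r ∣ ℕ.+ cost l ℕ.+ cost r ∎
    }
    where open _Improves_ imp
          open ℕP.≤-Reasoning

  improve-inside : ∀ {s′ s t} → s ⊑ t → s′ Improves s → ∃ λ t′ → t′ Improves t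
  improve-inside here      imp = _ , imp
  improve-inside (left q)  imp = let l′ , imp′ = improve-inside q imp in _ , node-improvesˡ _ imp′
  improve-inside (right q) imp = let r′ , imp′ = improve-inside q imp in _ , node-improvesʳ _ imp′

  -- p has the value, leaves and cost of node a b; so does node b a, hence one rotation lemma
  -- serves both orders of the children.
  record Joins (a b p : Tree) : Set where
    field
      value-≡  : value p ≡ value a + value b
      leaves-↭ : leaves p ↭ leaves a ++ leaves b
      cost-≡   : cost p ≡ ∣ value p ∣ ℕ.+ cost a ℕ.+ cost b

  node-joins : ∀ {l r} → Joins l r (node l r)
  node-joins = record { value-≡ = refl ; leaves-↭ = ↭-refl ; cost-≡ = refl }

  joins-comm : ∀ {a b p} → Joins a b p → Joins b a p
  joins-comm {a} {b} {p} J = record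
    { value-≡  = trans value-≡ (ℤP.+-comm (value a) (value b))
    ; leaves-↭ = ↭-trans leaves-↭ (↭.++-comm (leaves a) (leaves b))
    ; cost-≡   = trans cost-≡ (xy∙z≈xz∙y ∣ value p ∣ (cost a) (cost b))
    }
    where open Joins J

  rotate : ∀ {x y w c p} → Joins c w p → Joins x y c →
           ∣ value y + value w ∣ ℕ.< ∣ value c ∣ → node x (node y w) Improves p
  rotate {x} {y} {w} {c} {p} Jp Jc lt = record
    { value-≡  = value-≡
    ; leaves-↭ = ↭-sym (↭-trans (Joins.leaves-↭ Jp) (↭-trans (↭.++⁺ʳ (leaves w) (Joins.leaves-↭ Jc))
                   (↭.++-assoc (leaves x) (leaves y) (leaves w))))
    ; cost-<   = begin-strict
        ∣ value x + (value y + value w) ∣ ℕ.+ cost x ℕ.+ (∣ value y + value w ∣ ℕ.+ cost y ℕ.+ cost w)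
          ≡⟨ cong (λ v → ∣ v ∣ ℕ.+ cost x ℕ.+ (∣ value y + value w ∣ ℕ.+ cost y ℕ.+ cost w)) value-≡ ⟩
        ∣ value p ∣ ℕ.+ cost x ℕ.+ (∣ value y + value w ∣ ℕ.+ cost y ℕ.+ cost w)
          <⟨ shuffle-< ∣ value p ∣ (cost x) (cost y) (cost w) lt ⟩
        ∣ value p ∣ ℕ.+ (∣ value c ∣ ℕ.+ cost x ℕ.+ cost y) ℕ.+ cost w
          ≡⟨ cong (λ k → ∣ value p ∣ ℕ.+ k ℕ.+ cost w) (Joins.cost-≡ Jc) ⟨
        ∣ value p ∣ ℕ.+ cost c ℕ.+ cost w
          ≡⟨ Joins.cost-≡ Jp ⟨
        cost p ∎
    }
    where
    open ℕP.≤-Reasoning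

    value-≡ : value x + (value y + value w) ≡ value p
    value-≡ = sym (trans (Joins.value-≡ Jp) (trans (cong (_+ value w) (Joins.value-≡ Jc))
                (ℤP.+-assoc (value x) (value y) (value w))))

    shuffle-< : ∀ a cx cy cw {d e} → d ℕ.< e →
                a ℕ.+ cx ℕ.+ (d ℕ.+ cy ℕ.+ cw) ℕ.< a ℕ.+ (e ℕ.+ cx ℕ.+ cy) ℕ.+ cw
    shuffle-< a cx cy cw {d} {e} d<e = subst₂ ℕ._<_ (lhs a cx cy cw d) (rhs a cx cy cw e)
      (ℕP.+-monoʳ-< (a ℕ.+ cx ℕ.+ cy ℕ.+ cw) d<e)
      where
      lhs : ∀ a cx cy cw d → a ℕ.+ cx ℕ.+ cy ℕ.+ cw ℕ.+ d ≡ a ℕ.+ cx ℕ.+ (d ℕ.+ cy ℕ.+ cw)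
      lhs = ℕ-Solver.solve-∀
      rhs : ∀ a cx cy cw e → a ℕ.+ cx ℕ.+ cy ℕ.+ cw ℕ.+ e ≡ a ℕ.+ (e ℕ.+ cx ℕ.+ cy) ℕ.+ cw
      rhs = ℕ-Solver.solve-∀

  root-or-has-parent : ∀ {s t} → s ⊑ t → s ≡ t ⊎ ∃₂ λ w p → p ⊑ t × w ⊑ t × Joins s w p
  root-or-has-parent here = inj₁ refl
  root-or-has-parent (left q) with root-or-has-parent q
  ... | inj₁ refl                   = inj₂ (_ , _ , here , right here , node-joins)
  ... | inj₂ (w , p , p⊑ , w⊑ , J) = inj₂ (w , p , left p⊑ , left w⊑ , J)
  root-or-has-parent (right q) with root-or-has-parent q
  ... | inj₁ refl                   = inj₂ (_ , _ , here , left here , joins-comm node-joins)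
  ... | inj₂ (w , p , p⊑ , w⊑ , J) = inj₂ (w , p , right p⊑ , right w⊑ , J)

  peak : (Tree → ℕ) → Tree → ℕ
  peak f (leaf _)       = 0
  peak f t@(node l r)   = f t ⊔ peak f l ⊔ peak f r

  peak-≥ : ∀ f {l r t} → node l r ⊑ t → f (node l r) ℕ.≤ peak f t
  peak-≥ f here = ℕP.m≤n⇒m≤n⊔o _ (ℕP.m≤m⊔n _ _)
  peak-≥ f {t = node a b} (left q) =
    ℕP.m≤n⇒m≤n⊔o (peak f b) (ℕP.m≤n⇒m≤o⊔n (f (node a b)) (peak-≥ f q))
  peak-≥ f (right q) = ℕP.m≤n⇒m≤o⊔n _ (peak-≥ f q)

  peak-attained : ∀ f t → 0 ℕ.< peak f t → ∃₂ λ l r → node l r ⊑ t × f (node l r) ≡ peak f t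
  peak-attained f t@(node l r) 0<peak with ℕP.⊔-sel (f t ⊔ peak f l) (peak f r)
  ... | inj₂ ≡r =
    let a , b , q , fab≡ = peak-attained f r (subst (0 ℕ.<_) ≡r 0<peak)
    in a , b , right q , trans fab≡ (sym ≡r)
  ... | inj₁ ≡tl with ℕP.⊔-sel (f t) (peak f l)
  ...   | inj₁ ≡t = l , r , here , sym (trans ≡tl ≡t)
  ...   | inj₂ ≡l =
    let a , b , q , fab≡ = peak-attained f l (subst (0 ℕ.<_) (trans ≡tl ≡l) 0<peak)
    in a , b , left q , trans fab≡ (sym (trans ≡tl ≡l))

module IntegerLemmas where
  open import Data.Nat using (suc; z≤n; s≤s)
  open import Data.Product using (proj₁; proj₂)
  open import Data.Integer using (+_; -_; -[1+_]; 0ℤ; _+_; _-_; _*_; ∣_∣; _≤_; _<_; +≤+; -≤+)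
  open import Data.Integer.Tactic.RingSolver using (solve-∀)

  ∣i∣≤n⇒-n≤i≤n : ∀ {n} i → ∣ i ∣ ℕ.≤ n → - + n ≤ i × i ≤ + n
  ∣i∣≤n⇒-n≤i≤n (+ _)    ∣i∣≤n = ℤP.neg-≤-pos , +≤+ ∣i∣≤n
  ∣i∣≤n⇒-n≤i≤n -[1+ _ ] ∣i∣≤n = ℤP.neg-mono-≤ (+≤+ ∣i∣≤n) , -≤+

  n≤∣i∣⇒n≤i⊎i≤-n : ∀ {n} i → n ℕ.≤ ∣ i ∣ → + n ≤ i ⊎ i ≤ - + n
  n≤∣i∣⇒n≤i⊎i≤-n (+ _)    n≤∣i∣ = inj₁ (+≤+ n≤∣i∣)
  n≤∣i∣⇒n≤i⊎i≤-n -[1+ _ ] n≤∣i∣ = inj₂ (ℤP.neg-mono-≤ (+≤+ n≤∣i∣))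

  ∣i∣≡n⇒i≡±n : ∀ {n} i → ∣ i ∣ ≡ n → i ≡ + n ⊎ i ≡ - + n
  ∣i∣≡n⇒i≡±n (+ _)    refl = inj₁ refl
  ∣i∣≡n⇒i≡±n -[1+ _ ] refl = inj₂ refl

  ∣-i+-j∣≡∣i+j∣ : ∀ i j → ∣ - i + - j ∣ ≡ ∣ i + j ∣
  ∣-i+-j∣≡∣i+j∣ i j = trans (cong ∣_∣ (sym (ℤP.neg-distrib-+ i j))) (ℤP.∣-i∣≡∣i∣ (i + j))

  private
    rotation-criterion⁺ : ∀ {M} X Y W → 1 ℕ.≤ M → X + Y ≡ + M →
      ∣ X ∣ ℕ.≤ M → ∣ Y ∣ ℕ.≤ M → ∣ W ∣ ℕ.≤ M → ∣ X + Y + W ∣ ℕ.≤ M →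
      ∣ Y + W ∣ ℕ.< M ⊎ ∣ X + W ∣ ℕ.< M
    rotation-criterion⁺ {M} X Y W (s≤s z≤n) X+Y≡M ∣X∣≤M ∣Y∣≤M ∣W∣≤M ∣S∣≤M
      with ∣ Y + W ∣ ℕ.<? M | ∣ X + W ∣ ℕ.<? M
    ... | yes lt | _      = inj₁ lt
    ... | no _   | yes lt = inj₂ lt
    ... | no ≮₁  | no ≮₂  =
      ⊥-elim (both-large (n≤∣i∣⇒n≤i⊎i≤-n (X + W) (ℕP.≮⇒≥ ≮₂)) (n≤∣i∣⇒n≤i⊎i≤-n (Y + W) (ℕP.≮⇒≥ ≮₁)))
      where
      m = + M
      nonneg = ℤP.i≤j⇒0≤j-i

      negative-sum : ∀ {a b c} → 0ℤ ≤ a → 0ℤ ≤ b → 0ℤ ≤ c → a + b + (c + c) ≡ - (X + Y) → ⊥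
      negative-sum 0≤a 0≤b 0≤c eq
        with subst (0ℤ ≤_) (trans eq (cong -_ X+Y≡M))
               (ℤP.+-mono-≤ (ℤP.+-mono-≤ 0≤a 0≤b) (ℤP.+-mono-≤ 0≤c 0≤c))
      ... | ()

      -- In each case a non-negative combination of the hypotheses equals -(X + Y) = -M < 0.
      both-large : (m ≤ X + W ⊎ X + W ≤ - m) → (m ≤ Y + W ⊎ Y + W ≤ - m) → ⊥
      both-large (inj₁ u) (inj₁ v) =
        negative-sum (nonneg u) (nonneg v) (nonneg (proj₂ (∣i∣≤n⇒-n≤i≤n (X + Y + W) ∣S∣≤M))) (identity X Y W m)
        where
        identity : ∀ X Y W m →
          (X + W - m) + (Y + W - m) + ((m - (X + Y + W)) + (m - (X + Y + W))) ≡ - (X + Y)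
        identity = solve-∀
      both-large (inj₁ u) (inj₂ v) =
        negative-sum (nonneg u) (nonneg v) (nonneg (proj₂ (∣i∣≤n⇒-n≤i≤n X ∣X∣≤M))) (identity X Y W m)
        where
        identity : ∀ X Y W m →
          (X + W - m) + (- m - (Y + W)) + ((m - X) + (m - X)) ≡ - (X + Y)
        identity = solve-∀
      both-large (inj₂ u) (inj₁ v) =
        negative-sum (nonneg u) (nonneg v) (nonneg (proj₂ (∣i∣≤n⇒-n≤i≤n Y ∣Y∣≤M))) (identity X Y W m)
        where
        identity : ∀ X Y W m →
          (- m - (X + W)) + (Y + W - m) + ((m - Y) + (m - Y)) ≡ - (X + Y)
        identity = solve-∀
      both-large (inj₂ u) (inj₂ v) =
        negative-sum (nonneg u) (nonneg v) (nonneg (proj₁ (∣i∣≤n⇒-n≤i≤n W ∣W∣≤M))) (identity X Y W m)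
        where
        identity : ∀ X Y W m →
          (- m - (X + W)) + (- m - (Y + W)) + ((W - - m) + (W - - m)) ≡ - (X + Y)
        identity = solve-∀

  rotation-criterion : ∀ {M} X Y W → 1 ℕ.≤ M → ∣ X + Y ∣ ≡ M →
    ∣ X ∣ ℕ.≤ M → ∣ Y ∣ ℕ.≤ M → ∣ W ∣ ℕ.≤ M → ∣ X + Y + W ∣ ℕ.≤ M →
    ∣ Y + W ∣ ℕ.< M ⊎ ∣ X + W ∣ ℕ.< M
  rotation-criterion {M} X Y W 1≤M ∣X+Y∣≡M ∣X∣≤M ∣Y∣≤M ∣W∣≤M ∣S∣≤M with ∣i∣≡n⇒i≡±n (X + Y) ∣X+Y∣≡M
  ... | inj₁ X+Y≡M  = rotation-criterion⁺ X Y W 1≤M X+Y≡M ∣X∣≤M ∣Y∣≤M ∣W∣≤M ∣S∣≤M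
  ... | inj₂ X+Y≡-M =
    Sum.map (subst (ℕ._< M) (∣-i+-j∣≡∣i+j∣ Y W)) (subst (ℕ._< M) (∣-i+-j∣≡∣i+j∣ X W))
      (rotation-criterion⁺ (- X) (- Y) (- W) 1≤M -X-Y≡M
        (negated X ∣X∣≤M) (negated Y ∣Y∣≤M) (negated W ∣W∣≤M)
        (subst (ℕ._≤ M) (sym ∣-S∣≡∣S∣) ∣S∣≤M))
    where
    negated : ∀ i → ∣ i ∣ ℕ.≤ M → ∣ - i ∣ ℕ.≤ M
    negated i = subst (ℕ._≤ M) (sym (ℤP.∣-i∣≡∣i∣ i))

    -X-Y≡M : - X + - Y ≡ + M
    -X-Y≡M = trans (sym (ℤP.neg-distrib-+ X Y)) (trans (cong -_ X+Y≡-M) (ℤP.neg-involutive (+ M)))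

    ∣-S∣≡∣S∣ : ∣ - X + - Y + - W ∣ ≡ ∣ X + Y + W ∣
    ∣-S∣≡∣S∣ = trans (cong (λ s → ∣ s + - W ∣) (sym (ℤP.neg-distrib-+ X Y))) (∣-i+-j∣≡∣i+j∣ (X + Y) W)

  smaller-class⇒smaller-abs : ∀ {H} v w k k′ →
    ∣ + 3 * v - k * + H ∣ ℕ.+ ∣ + 3 * w - k′ * + H ∣ ℕ.< H → ∣ k ∣ ℕ.< ∣ k′ ∣ → ∣ v ∣ ℕ.< ∣ w ∣
  smaller-class⇒smaller-abs {H} v w k k′ small ∣k∣<∣k′∣ =
    ℕP.*-cancelˡ-< 3 ∣ v ∣ ∣ w ∣ (ℕP.+-cancelʳ-< H (3 ℕ.* ∣ v ∣) (3 ℕ.* ∣ w ∣) (begin-strict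
      3 ℕ.* ∣ v ∣ ℕ.+ H                 ≤⟨ ℕP.+-monoˡ-≤ H (3∣u∣≤ v k) ⟩
      (∣ k ∣) ℕ.* H ℕ.+ ε ℕ.+ H         ≡⟨ shift-H ∣ k ∣ H ε ⟩
      suc ∣ k ∣ ℕ.* H ℕ.+ ε             ≤⟨ ℕP.+-monoˡ-≤ ε (ℕP.*-monoˡ-≤ H ∣k∣<∣k′∣) ⟩
      (∣ k′ ∣) ℕ.* H ℕ.+ ε              ≤⟨ ℕP.+-monoˡ-≤ ε (∣j∣H≤ w k′) ⟩
      3 ℕ.* ∣ w ∣ ℕ.+ ε′ ℕ.+ ε          ≡⟨ swap-errors (3 ℕ.* ∣ w ∣) ε′ ε ⟩
      3 ℕ.* ∣ w ∣ ℕ.+ (ε ℕ.+ ε′)        <⟨ ℕP.+-monoʳ-< (3 ℕ.* ∣ w ∣) small ⟩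
      3 ℕ.* ∣ w ∣ ℕ.+ H                 ∎))
    where
    open ℕP.≤-Reasoning
    ε  = ∣ + 3 * v - k * + H ∣
    ε′ = ∣ + 3 * w - k′ * + H ∣

    shift-H : ∀ a h x → a ℕ.* h ℕ.+ x ℕ.+ h ≡ suc a ℕ.* h ℕ.+ x
    shift-H = ℕ-Solver.solve-∀
    swap-errors : ∀ a x y → a ℕ.+ x ℕ.+ y ≡ a ℕ.+ (y ℕ.+ x)
    swap-errors = ℕ-Solver.solve-∀
    split : ∀ a b → a ≡ b + (a - b)
    split = solve-∀
    cosplit : ∀ a b → b ≡ a - (a - b)
    cosplit = solve-∀

    3∣u∣≤ : ∀ u j → 3 ℕ.* ∣ u ∣ ℕ.≤ (∣ j ∣) ℕ.* H ℕ.+ ∣ + 3 * u - j * + H ∣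
    3∣u∣≤ u j = begin
      3 ℕ.* ∣ u ∣                                ≡⟨ ℤP.∣i*j∣≡∣i∣*∣j∣ (+ 3) u ⟨
      ∣ + 3 * u ∣                                ≡⟨ cong ∣_∣ (split (+ 3 * u) (j * + H)) ⟩
      ∣ j * + H + (+ 3 * u - j * + H) ∣          ≤⟨ ℤP.∣i+j∣≤∣i∣+∣j∣ (j * + H) _ ⟩
      (∣ j * + H ∣) ℕ.+ ∣ + 3 * u - j * + H ∣    ≡⟨ cong (ℕ._+ ∣ + 3 * u - j * + H ∣) (ℤP.∣i*j∣≡∣i∣*∣j∣ j (+ H)) ⟩
      (∣ j ∣) ℕ.* H ℕ.+ ∣ + 3 * u - j * + H ∣    ∎

    ∣j∣H≤ : ∀ u j → (∣ j ∣) ℕ.* H ℕ.≤ 3 ℕ.* ∣ u ∣ ℕ.+ ∣ + 3 * u - j * + H ∣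
    ∣j∣H≤ u j = begin
      ∣ j ∣ ℕ.* H                                ≡⟨ ℤP.∣i*j∣≡∣i∣*∣j∣ j (+ H) ⟨
      ∣ j * + H ∣                                ≡⟨ cong ∣_∣ (cosplit (+ 3 * u) (j * + H)) ⟩
      ∣ + 3 * u - (+ 3 * u - j * + H) ∣          ≤⟨ ℤP.∣i-j∣≤∣i∣+∣j∣ (+ 3 * u) _ ⟩
      (∣ + 3 * u ∣) ℕ.+ ∣ + 3 * u - j * + H ∣    ≡⟨ cong (ℕ._+ ∣ + 3 * u - j * + H ∣) (ℤP.∣i*j∣≡∣i∣*∣j∣ (+ 3) u) ⟩
      3 ℕ.* ∣ u ∣ ℕ.+ ∣ + 3 * u - j * + H ∣      ∎

  positive⇒nonneg-class : ∀ {H} v k → 0ℤ < v → ∣ + 3 * v - k * + H ∣ ℕ.< H → 0ℤ ≤ k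
  positive⇒nonneg-class _        (+ _)    _  _     = +≤+ z≤n
  positive⇒nonneg-class {H} (+ v) -[1+ j ] _  small = ⊥-elim (ℕP.<⇒≱ small H≤∣e∣)
    where
    open ℕP.≤-Reasoning
    minus-neg : ∀ a n h → a - (- n) * h ≡ a + n * h
    minus-neg = solve-∀

    H≤∣e∣ : H ℕ.≤ ∣ + 3 * + v - -[1+ j ] * + H ∣
    H≤∣e∣ = begin
      H                                      ≤⟨ ℕP.m≤m+n H (j ℕ.* H) ⟩
      suc j ℕ.* H                            ≤⟨ ℕP.m≤n+m (suc j ℕ.* H) (3 ℕ.* v) ⟩
      ∣ + (3 ℕ.* v) + + (suc j ℕ.* H) ∣      ≡⟨ cong₂ (λ a b → ∣ a + b ∣) (ℤP.pos-* 3 v) (ℤP.pos-* (suc j) H) ⟩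
      ∣ + 3 * + v + + suc j * + H ∣          ≡⟨ cong ∣_∣ (minus-neg (+ 3 * + v) (+ suc j) (+ H)) ⟨
      ∣ + 3 * + v - -[1+ j ] * + H ∣         ∎
  positive⇒nonneg-class -[1+ _ ] -[1+ _ ] () _

  negative⇒nonpos-class : ∀ {H} v k → v < 0ℤ → ∣ + 3 * v - k * + H ∣ ℕ.< H → k ≤ 0ℤ
  negative⇒nonpos-class {H} v k v<0 small =
    subst (_≤ 0ℤ) (ℤP.neg-involutive k)
      (ℤP.neg-mono-≤ (positive⇒nonneg-class (- v) (- k) (ℤP.neg-mono-< v<0) small′))
    where
    negate : ∀ v k h → - (+ 3 * v - k * h) ≡ + 3 * - v - - k * h
    negate = solve-∀

    small′ : ∣ + 3 * - v - - k * + H ∣ ℕ.< H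
    small′ = subst (ℕ._< H) (trans (sym (ℤP.∣-i∣≡∣i∣ (+ 3 * v - k * + H))) (cong ∣_∣ (negate v k (+ H)))) small

  classify-nonneg : ∀ {k} → 0ℤ ≤ k → ∣ k ∣ ℕ.≤ 2 → k ≡ 0ℤ ⊎ k ≡ + 1 ⊎ k ≡ + 2
  classify-nonneg {+ 0}                 _  _                 = inj₁ refl
  classify-nonneg {+ 1}                 _  _                 = inj₂ (inj₁ refl)
  classify-nonneg {+ 2}                 _  _                 = inj₂ (inj₂ refl)
  classify-nonneg {+ suc (suc (suc _))} _  (s≤s (s≤s ()))
  classify-nonneg { -[1+ _ ]}           ()

  classify-nonpos : ∀ {k} → k ≤ 0ℤ → ∣ k ∣ ℕ.≤ 2 → k ≡ 0ℤ ⊎ k ≡ - + 1 ⊎ k ≡ - + 2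
  classify-nonpos {+ 0}                   _        _  = inj₁ refl
  classify-nonpos {+ suc _}               (+≤+ ())
  classify-nonpos { -[1+ 0 ]}             _        _  = inj₂ (inj₁ refl)
  classify-nonpos { -[1+ 1 ]}             _        _  = inj₂ (inj₂ refl)
  classify-nonpos { -[1+ suc (suc _) ]}   _        (s≤s (s≤s ()))

module Classes (H : ℕ) (cls : ℤ → ℤ) where
  open import Data.Nat using (z≤n; s≤s)
  open import Data.Integer using (+_; -_; 0ℤ; _+_; _-_; _*_; ∣_∣; _≤_; _<_)
  open import Data.Integer.Tactic.RingSolver using (solve-∀)
  open AdditionTrees
  open ListSums
  open IntegerLemmas

  N : Tree → ℤ
  N t = sumℤ (map cls (leaves t))

  N-↭ : ∀ {t xs} → leaves t ↭ xs → N t ≡ sumℤ (map cls xs)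
  N-↭ p = sumℤ-↭ (↭.map⁺ cls p)

  N-joins : ∀ {a b p} → Joins a b p → N p ≡ N a + N b
  N-joins {a} {b} {p} J = begin
    N p                                              ≡⟨ N-↭ {p} (Joins.leaves-↭ J) ⟩
    sumℤ (map cls (leaves a ++ leaves b))            ≡⟨ cong sumℤ (List.map-++ cls (leaves a) (leaves b)) ⟩
    sumℤ (map cls (leaves a) ++ map cls (leaves b))  ≡⟨ sumℤ-++ (map cls (leaves a)) (map cls (leaves b)) ⟩
    N a + N b                                        ∎
    where open ≡-Reasoning

  N-node : ∀ {l r} → N (node l r) ≡ N l + N r
  N-node {l} {r} = N-joins (node-joins {l} {r})

  N-leaf : ∀ {x} → N (leaf x) ≡ cls x
  N-leaf {x} = ℤP.+-identityʳ (cls x)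

  leafError : ℤ → ℤ
  leafError x = + 3 * x - cls x * + H

  error : Tree → ℤ
  error t = + 3 * value t - N t * + H

  budget : Tree → ℕ
  budget t = sum (map (∣_∣ ∘ leafError) (leaves t))

  budget-↭ : ∀ {t xs} → leaves t ↭ xs → budget t ≡ sum (map (∣_∣ ∘ leafError) xs)
  budget-↭ p = ℕSum.sum-↭ (↭.map⁺ (∣_∣ ∘ leafError) p)

  budget-joins : ∀ {a b p} → Joins a b p → budget p ≡ budget a ℕ.+ budget b
  budget-joins {a} {b} {p} J = begin
    budget p                                      ≡⟨ budget-↭ {p} (Joins.leaves-↭ J) ⟩
    sum (map f (leaves a ++ leaves b))            ≡⟨ cong sum (List.map-++ f (leaves a) (leaves b)) ⟩
    sum (map f (leaves a) ++ map f (leaves b))    ≡⟨ ℕSum.sum-++ (map f (leaves a)) (map f (leaves b)) ⟩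
    budget a ℕ.+ budget b                         ∎
    where open ≡-Reasoning
          f = ∣_∣ ∘ leafError

  budget-node : ∀ {l r} → budget (node l r) ≡ budget l ℕ.+ budget r
  budget-node {l} {r} = budget-joins (node-joins {l} {r})

  budget-⊑ : ∀ {s t} → s ⊑ t → budget s ℕ.≤ budget t
  budget-⊑ here = ℕP.≤-refl
  budget-⊑ {t = node l r} (left q)  = ℕP.≤-trans (budget-⊑ q)
    (ℕP.≤-trans (ℕP.m≤m+n (budget l) (budget r)) (ℕP.≤-reflexive (sym (budget-node {l} {r}))))
  budget-⊑ {t = node l r} (right q) = ℕP.≤-trans (budget-⊑ q)
    (ℕP.≤-trans (ℕP.m≤n+m (budget r) (budget l)) (ℕP.≤-reflexive (sym (budget-node {l} {r}))))

  ∣error∣≤budget : ∀ t → ∣ error t ∣ ℕ.≤ budget t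
  ∣error∣≤budget (leaf x) = ℕP.≤-reflexive (begin
    ∣ + 3 * x - N (leaf x) * + H ∣   ≡⟨ cong (λ k → ∣ + 3 * x - k * + H ∣) N-leaf ⟩
    ∣ leafError x ∣                  ≡⟨ ℕP.+-identityʳ ∣ leafError x ∣ ⟨
    budget (leaf x)                  ∎)
    where open ≡-Reasoning
  ∣error∣≤budget (node l r) = begin
    ∣ error (node l r) ∣             ≡⟨ cong ∣_∣ error-node ⟩
    ∣ error l + error r ∣            ≤⟨ ℤP.∣i+j∣≤∣i∣+∣j∣ (error l) (error r) ⟩
    ∣ error l ∣ ℕ.+ ∣ error r ∣      ≤⟨ ℕP.+-mono-≤ (∣error∣≤budget l) (∣error∣≤budget r) ⟩
    budget l ℕ.+ budget r            ≡⟨ budget-node {l} {r} ⟨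
    budget (node l r)                ∎
    where
    open ℕP.≤-Reasoning
    distribute : ∀ x y m n h → + 3 * (x + y) - (m + n) * h ≡ (+ 3 * x - m * h) + (+ 3 * y - n * h)
    distribute = solve-∀
    error-node : error (node l r) ≡ error l + error r
    error-node = trans (cong (λ k → + 3 * value (node l r) - k * + H) (N-node {l} {r}))
                       (distribute (value l) (value r) (N l) (N r) (+ H))

  module MinimumCost
      (cls-range : ∀ x → cls x ≡ - + 3 ⊎ ∣ cls x ∣ ℕ.≤ 2)
      (X : List ℤ) (X-balanced : sumℤ (map cls X) ≡ 0ℤ)
      (E : ℕ) (X-budget : sum (map (∣_∣ ∘ leafError) X) ℕ.≤ E) (2E<H : E ℕ.+ E ℕ.< H)
      (T : Tree) (T-over : leaves T ↭ X) (T-minimal : ∀ T′ → leaves T′ ↭ X → cost T ℕ.≤ cost T′)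
      where

    N-root : N T ≡ 0ℤ
    N-root = trans (N-↭ {T} T-over) X-balanced

    budget≤E : ∀ {s} → s ⊑ T → budget s ℕ.≤ E
    budget≤E s⊑T = ℕP.≤-trans (budget-⊑ s⊑T) (ℕP.≤-trans (ℕP.≤-reflexive (budget-↭ {T} T-over)) X-budget)

    no-improvement : ∀ {s s′} → s ⊑ T → ¬ (s′ Improves s)
    no-improvement s⊑T imp =
      let T′ , imp′ = improve-inside s⊑T imp
      in ℕP.<⇒≱ (_Improves_.cost-< imp′) (T-minimal T′ (↭-trans (_Improves_.leaves-↭ imp′) T-over))

    smaller-value : ∀ {a b} → budget a ℕ.≤ E → budget b ℕ.≤ E →
                    ∣ N a ∣ ℕ.< ∣ N b ∣ → ∣ value a ∣ ℕ.< ∣ value b ∣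
    smaller-value {a} {b} a≤E b≤E =
      smaller-class⇒smaller-abs (value a) (value b) (N a) (N b)
        (ℕP.≤-<-trans (ℕP.+-mono-≤ (ℕP.≤-trans (∣error∣≤budget a) a≤E) (ℕP.≤-trans (∣error∣≤budget b) b≤E)) 2E<H)

    cannot-rotate : ∀ {x y w c p} → p ⊑ T → Joins c w p → Joins x y c →
                    ∣ N y + N w ∣ ℕ.< ∣ N c ∣ → ⊥
    cannot-rotate {x} {y} {w} {c} {p} p⊑T Jp Jc ∣Ny+Nw∣<∣Nc∣ =
      no-improvement p⊑T (rotate Jp Jc (smaller-value {node y w} {c}
        (ℕP.≤-trans budget-yw≤ (budget≤E p⊑T)) (ℕP.≤-trans budget-c≤ (budget≤E p⊑T))
        (subst (ℕ._< ∣ N c ∣) (cong ∣_∣ (sym (N-node {y} {w}))) ∣Ny+Nw∣<∣Nc∣)))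
      where
      open ℕP.≤-Reasoning
      budget-c≤ : budget c ℕ.≤ budget p
      budget-c≤ = ℕP.≤-trans (ℕP.m≤m+n (budget c) (budget w)) (ℕP.≤-reflexive (sym (budget-joins Jp)))

      budget-yw≤ : budget (node y w) ℕ.≤ budget p
      budget-yw≤ = begin
        budget (node y w)                      ≡⟨ budget-node {y} {w} ⟩
        budget y ℕ.+ budget w                  ≤⟨ ℕP.+-monoˡ-≤ (budget w) (ℕP.m≤n+m (budget y) (budget x)) ⟩
        budget x ℕ.+ budget y ℕ.+ budget w     ≡⟨ cong (ℕ._+ budget w) (budget-joins Jc) ⟨
        budget c ℕ.+ budget w                  ≡⟨ budget-joins Jp ⟨
        budget p                               ∎

    leaf-class-≤3 : ∀ x → ∣ N (leaf x) ∣ ℕ.≤ 3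
    leaf-class-≤3 x with cls-range x
    ... | inj₁ cls≡-3   = ℕP.≤-reflexive (cong ∣_∣ (trans N-leaf cls≡-3))
    ... | inj₂ ∣cls∣≤2 = ℕP.m≤n⇒m≤1+n (subst (λ k → ∣ k ∣ ℕ.≤ 2) (sym N-leaf) ∣cls∣≤2)

    ∣N∣≤peak : 3 ℕ.≤ peak (∣_∣ ∘ N) T → ∀ {s} → s ⊑ T → ∣ N s ∣ ℕ.≤ peak (∣_∣ ∘ N) T
    ∣N∣≤peak 3≤peak {leaf x}   _   = ℕP.≤-trans (leaf-class-≤3 x) 3≤peak
    ∣N∣≤peak 3≤peak {node l r} s⊑T = peak-≥ (∣_∣ ∘ N) s⊑T

    no-peak-node-below-root : ∀ {x y w p} → 3 ℕ.≤ peak (∣_∣ ∘ N) T →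
      ∣ N (node x y) ∣ ≡ peak (∣_∣ ∘ N) T → node x y ⊑ T → p ⊑ T → w ⊑ T → Joins (node x y) w p → ⊥
    no-peak-node-below-root {x} {y} {w} {p} 3≤M ∣Nc∣≡M c⊑T p⊑T w⊑T Jp =
      Sum.[ (λ ∣Ny+Nw∣<M → cannot-rotate p⊑T Jp node-joins (below-N-c ∣Ny+Nw∣<M))
          , (λ ∣Nx+Nw∣<M → cannot-rotate p⊑T Jp (joins-comm node-joins) (below-N-c ∣Nx+Nw∣<M))
          ] (rotation-criterion (N x) (N y) (N w) (ℕP.≤-trans (s≤s z≤n) 3≤M)
               (trans (cong ∣_∣ (sym (N-node {x} {y}))) ∣Nc∣≡M)
               (bound (⊑-trans (left here) c⊑T)) (bound (⊑-trans (right here) c⊑T)) (bound w⊑T)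
               (subst (ℕ._≤ peak (∣_∣ ∘ N) T) (cong ∣_∣ N-p) (bound p⊑T)))
      where
      bound = ∣N∣≤peak 3≤M
      N-p : N p ≡ N x + N y + N w
      N-p = trans (N-joins Jp) (cong (_+ N w) (N-node {x} {y}))
      below-N-c : ∀ {n} → n ℕ.< peak (∣_∣ ∘ N) T → n ℕ.< ∣ N (node x y) ∣
      below-N-c = subst (_ ℕ.<_) (sym ∣Nc∣≡M)

    no-peak-above-2 : 3 ℕ.≤ peak (∣_∣ ∘ N) T → ⊥
    no-peak-above-2 3≤M with peak-attained (∣_∣ ∘ N) T (ℕP.≤-trans (s≤s z≤n) 3≤M)
    ... | x , y , c⊑T , ∣Nc∣≡M with root-or-has-parent c⊑T
    ...   | inj₂ (w , p , p⊑T , w⊑T , Jp) = no-peak-node-below-root 3≤M ∣Nc∣≡M c⊑T p⊑T w⊑T Jp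
    ...   | inj₁ c≡T
      with subst (3 ℕ.≤_) (trans (sym ∣Nc∣≡M) (trans (cong (∣_∣ ∘ N) c≡T) (cong ∣_∣ N-root))) 3≤M
    ...     | ()

    peak≤2 : peak (∣_∣ ∘ N) T ℕ.≤ 2
    peak≤2 = ℕP.≮⇒≥ no-peak-above-2

    internal-class-≤2 : ∀ {l r} → node l r ⊑ T → ∣ N (node l r) ∣ ℕ.≤ 2
    internal-class-≤2 q = ℕP.≤-trans (peak-≥ (∣_∣ ∘ N) q) peak≤2

    Near : ℤ → ℤ → Set
    Near k z = ∣ + 3 * z - k * + H ∣ ℕ.≤ E

    near-own-class : ∀ {s} → s ⊑ T → Near (N s) (value s)
    near-own-class {s} s⊑T = ℕP.≤-trans (∣error∣≤budget s) (budget≤E s⊑T)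

    error<H : ∀ {s} → s ⊑ T → ∣ error s ∣ ℕ.< H
    error<H s⊑T = ℕP.≤-<-trans (near-own-class s⊑T) (ℕP.≤-<-trans (ℕP.m≤m+n E E) 2E<H)

    nonneg-class-≤2 : ∀ {s} → s ⊑ T → 0ℤ ≤ N s → ∣ N s ∣ ℕ.≤ 2
    nonneg-class-≤2 {node l r} s⊑T _ = internal-class-≤2 s⊑T
    nonneg-class-≤2 {leaf x}   _   0≤N with cls-range x
    ... | inj₂ ∣cls∣≤2 = subst (λ k → ∣ k ∣ ℕ.≤ 2) (sym N-leaf) ∣cls∣≤2
    ... | inj₁ cls≡-3 with subst (0ℤ ≤_) (trans N-leaf cls≡-3) 0≤N
    ...   | ()

    one-of : ∀ {k z a b c} → k ≡ a ⊎ k ≡ b ⊎ k ≡ c → Near k z → Near a z ⊎ Near b z ⊎ Near c z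
    one-of (inj₁ refl)        near = inj₁ near
    one-of (inj₂ (inj₁ refl)) near = inj₂ (inj₁ near)
    one-of (inj₂ (inj₂ refl)) near = inj₂ (inj₂ near)

    positive-node : ∀ {z} → z ∈ nodes T → 0ℤ < z → Near 0ℤ z ⊎ Near (+ 1) z ⊎ Near (+ 2) z
    positive-node z∈ 0<z with ∈nodes⇒⊑ T z∈
    ... | s , s⊑T , refl =
      one-of {z = value s} (classify-nonneg 0≤N (nonneg-class-≤2 s⊑T 0≤N)) (near-own-class s⊑T)
      where 0≤N = positive⇒nonneg-class (value s) (N s) 0<z (error<H s⊑T)

    negative-internal-node : ∀ {z} → z ∈ internalNodes T → z < 0ℤ →
                             Near 0ℤ z ⊎ Near (- + 1) z ⊎ Near (- + 2) z
    negative-internal-node z∈ z<0 with ∈internalNodes⇒⊑ T z∈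
    ... | l , r , s⊑T , refl =
      one-of {z = value (node l r)} (classify-nonpos N≤0 (internal-class-≤2 s⊑T)) (near-own-class s⊑T)
      where N≤0 = negative⇒nonpos-class (value (node l r)) (N (node l r)) z<0 (error<H s⊑T)

module Reduction (m K : ℕ) (b : Fin (3 ℕ.* m) → ℕ) (m≥1 : 1 ℕ.≤ m) (K≥1 : 1 ℕ.≤ K) (b≤K : ∀ i → b i ℕ.≤ K)
    where
  open Setting m K b
  open import Data.Nat using (zero; suc; _+_; _*_; _≤_; _<_; z≤n; s≤s; _≤?_; NonZero; >-nonZero)
  open import Data.Nat.DivMod using (/-monoˡ-≤; m*n/n≡m)
  open import Data.Integer as ℤ using (+_; -_; -[1+_]; 0ℤ; ∣_∣)
  open import Data.Integer.Tactic.RingSolver using (solve-∀)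
  open import Data.Bool using (true; false; if_then_else_)
  open import Relation.Nullary using (does)
  open import Relation.Nullary.Decidable using (dec-true; dec-false)
  open ListSums

  private
    S : ℕ
    S = 5 * m * (5 * m)

    instance
      m≢0 : NonZero m
      m≢0 = >-nonZero m≥1
      K≢0 : NonZero K
      K≢0 = >-nonZero K≥1
      S≢0 : NonZero S
      S≢0 = ℕP.m*n≢0 (5 * m) (5 * m) {{ℕP.m*n≢0 5 m}} {{ℕP.m*n≢0 5 m}}

  div-≤ : ∀ a c d → a ≤ c * d → a div d ≤ c
  div-≤ a c zero    _    = z≤n
  div-≤ a c (suc d) a≤cd = ℕP.≤-trans (/-monoˡ-≤ (suc d) a≤cd) (ℕP.≤-reflexive (m*n/n≡m c (suc d)))

  K≤SK : K ≤ S * K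
  K≤SK = ℕP.m≤n*m K S

  m≤S : m ≤ S
  m≤S = ℕP.≤-trans (ℕP.m≤n*m m 5) (ℕP.m≤m*n (5 * m) (5 * m) {{ℕP.m*n≢0 5 m}})

  h≤4K : hₙ ≤ 4 * K
  h≤4K = div-≤ (4 * Lₙ) (4 * K) (400 * S) (begin
    4 * Lₙ                          ≡⟨ expand S K ⟩
    1200 * (S * K) + 4 * K          ≤⟨ ℕP.+-monoʳ-≤ (1200 * (S * K)) (ℕP.*-mono-≤ (ℕP.m≤m+n 4 396) K≤SK) ⟩
    1200 * (S * K) + 400 * (S * K)  ≡⟨ collect S K ⟩
    4 * K * (400 * S)               ∎)
    where
    open ℕP.≤-Reasoning
    expand : ∀ S K → 4 * (3 * (100 * S * K) + K) ≡ 1200 * (S * K) + 4 * K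
    expand = ℕ-Solver.solve-∀
    collect : ∀ S K → 1200 * (S * K) + 400 * (S * K) ≡ 4 * K * (400 * S)
    collect = ℕ-Solver.solve-∀

  H≥1 : 1 ≤ Hₙ
  H≥1 = ℕP.≤-trans K≥1 (ℕP.≤-trans (ℕP.m≤n+m K (3 * Wₙ)) (ℕP.m≤m+n Lₙ hₙ))

  3W≤H : 3 * Wₙ ≤ Hₙ
  3W≤H = ℕP.≤-trans (ℕP.m≤m+n (3 * Wₙ) K) (ℕP.m≤m+n Lₙ hₙ)

  h<a : ∀ i → hₙ < aₙ i
  h<a i = begin-strict
    hₙ                ≤⟨ h≤4K ⟩
    4 * K             <⟨ ℕP.*-monoˡ-< K (ℕP.m≤m+n 5 95) ⟩
    100 * K           ≤⟨ ℕP.*-monoʳ-≤ 100 K≤SK ⟩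
    100 * (S * K)     ≡⟨ ℕP.*-assoc 100 S K ⟨
    Wₙ                ≤⟨ ℕP.m≤n+m Wₙ (b i) ⟩
    aₙ i              ∎
    where open ℕP.≤-Reasoning

  E : ℕ
  E = 36 * m * K

  2E<H : E + E < Hₙ
  2E<H = begin-strict
    E + E                 ≡⟨ double m K ⟩
    72 * (m * K)          ≤⟨ ℕP.*-monoʳ-≤ 72 (ℕP.*-monoˡ-≤ K m≤S) ⟩
    72 * (S * K)          ≤⟨ ℕP.*-monoˡ-≤ (S * K) (ℕP.m≤m+n 72 228) ⟩
    300 * (S * K)         ≡⟨ triple S K ⟩
    3 * Wₙ                <⟨ ℕP.m<m+n (3 * Wₙ) K≥1 ⟩
    Lₙ                    ≤⟨ ℕP.m≤m+n Lₙ hₙ ⟩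
    Hₙ                    ∎
    where
    open ℕP.≤-Reasoning
    double : ∀ m K → 36 * m * K + 36 * m * K ≡ 72 * (m * K)
    double = ℕ-Solver.solve-∀
    triple : ∀ S K → 300 * (S * K) ≡ 3 * (100 * S * K)
    triple = ℕ-Solver.solve-∀

  500mE≤3H : 500 * m * E ≤ 3 * Hₙ
  500mE≤3H = begin
    500 * m * (36 * m * K)    ≡⟨ square m K ⟩
    720 * (S * K)             ≤⟨ ℕP.*-monoˡ-≤ (S * K) (ℕP.m≤m+n 720 180) ⟩
    900 * (S * K)             ≡⟨ nine S K ⟩
    3 * (3 * Wₙ)              ≤⟨ ℕP.*-monoʳ-≤ 3 3W≤H ⟩
    3 * Hₙ                    ∎
    where
    open ℕP.≤-Reasoning
    square : ∀ m K → 500 * m * (36 * m * K) ≡ 720 * (5 * m * (5 * m) * K)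
    square = ℕ-Solver.solve-∀
    nine : ∀ S K → 900 * (S * K) ≡ 3 * (3 * (100 * S * K))
    nine = ℕ-Solver.solve-∀

  -- The labels of X are -H < 0 ≤ h < aᵢ, of classes -3, 0 and 1 (3 aᵢ ≈ H).
  classOf : ℤ → ℤ
  classOf -[1+ _ ] = - + 3
  classOf (+ n)    = if does (n ≤? hₙ) then 0ℤ else + 1

  open Classes Hₙ classOf public

  classOf-range : ∀ x → classOf x ≡ - + 3 ⊎ ∣ classOf x ∣ ≤ 2
  classOf-range -[1+ _ ] = inj₁ refl
  classOf-range (+ n) with does (n ≤? hₙ)
  ... | true  = inj₂ z≤n
  ... | false = inj₂ (s≤s z≤n)

  classOf-negative : ∀ {n} → 1 ≤ n → classOf (- + n) ≡ - + 3
  classOf-negative {suc _} _ = refl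

  classOf-h : classOf (+ hₙ) ≡ 0ℤ
  classOf-h = cong (if_then 0ℤ else + 1) (dec-true (hₙ ≤? hₙ) ℕP.≤-refl)

  classOf-a : ∀ i → classOf (+ aₙ i) ≡ + 1
  classOf-a i = cong (if_then 0ℤ else + 1) (dec-false (aₙ i ≤? hₙ) (ℕP.<⇒≱ (h<a i)))

  map-X : ∀ {B : Set} (f : ℤ → B) →
          map f X ≡ tabulate (f ∘ +_ ∘ aₙ) ++ (replicate m (f (- + Hₙ)) ++ replicate m (f (+ hₙ)))
  map-X f = trans (List.map-++ f (tabulate (+_ ∘ aₙ)) (replicate m (- + Hₙ) ++ replicate m (+ hₙ)))
    (cong₂ _++_ (List.map-tabulate (+_ ∘ aₙ) f)
      (trans (List.map-++ f (replicate m (- + Hₙ)) (replicate m (+ hₙ)))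
        (cong₂ _++_ (List.map-replicate f m (- + Hₙ)) (List.map-replicate f m (+ hₙ)))))

  sumℤ-map-X : ∀ f → sumℤ (map f X) ≡
               sumℤ (tabulate (f ∘ +_ ∘ aₙ)) ℤ.+ (+ m ℤ.* f (- + Hₙ) ℤ.+ + m ℤ.* f (+ hₙ))
  sumℤ-map-X f = begin
    sumℤ (map f X)
      ≡⟨ cong sumℤ (map-X f) ⟩
    sumℤ (tabulate (f ∘ +_ ∘ aₙ) ++ (replicate m (f (- + Hₙ)) ++ replicate m (f (+ hₙ))))
      ≡⟨ sumℤ-++ (tabulate (f ∘ +_ ∘ aₙ)) _ ⟩
    sumℤ (tabulate (f ∘ +_ ∘ aₙ)) ℤ.+ sumℤ (replicate m (f (- + Hₙ)) ++ replicate m (f (+ hₙ)))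
      ≡⟨ cong (ℤ._+_ (sumℤ (tabulate (f ∘ +_ ∘ aₙ)))) (trans (sumℤ-++ (replicate m (f (- + Hₙ))) _)
           (cong₂ ℤ._+_ (sumℤ-replicate m (f (- + Hₙ))) (sumℤ-replicate m (f (+ hₙ))))) ⟩
    sumℤ (tabulate (f ∘ +_ ∘ aₙ)) ℤ.+ (+ m ℤ.* f (- + Hₙ) ℤ.+ + m ℤ.* f (+ hₙ)) ∎
    where open ≡-Reasoning

  X-balanced : sumℤ (map classOf X) ≡ 0ℤ
  X-balanced = begin
    sumℤ (map classOf X)
      ≡⟨ sumℤ-map-X classOf ⟩
    sumℤ (tabulate (classOf ∘ +_ ∘ aₙ)) ℤ.+ (+ m ℤ.* classOf (- + Hₙ) ℤ.+ + m ℤ.* classOf (+ hₙ))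
      ≡⟨ cong₂ ℤ._+_ (sumℤ-tabulate-const (classOf ∘ +_ ∘ aₙ) classOf-a)
           (cong₂ (λ c c′ → + m ℤ.* c ℤ.+ + m ℤ.* c′) (classOf-negative H≥1) classOf-h) ⟩
    + (3 * m) ℤ.* + 1 ℤ.+ (+ m ℤ.* - + 3 ℤ.+ + m ℤ.* 0ℤ)
      ≡⟨ cong (λ t → t ℤ.* + 1 ℤ.+ (+ m ℤ.* - + 3 ℤ.+ + m ℤ.* 0ℤ)) (ℤP.pos-* 3 m) ⟩
    + 3 ℤ.* + m ℤ.* + 1 ℤ.+ (+ m ℤ.* - + 3 ℤ.+ + m ℤ.* 0ℤ)
      ≡⟨ cancel (+ m) ⟩
    0ℤ ∎
    where
    open ≡-Reasoning
    cancel : ∀ n → + 3 ℤ.* n ℤ.* + 1 ℤ.+ (n ℤ.* - + 3 ℤ.+ n ℤ.* 0ℤ) ≡ 0ℤ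
    cancel = solve-∀

  leafError-H : ∣ leafError (- + Hₙ) ∣ ≡ 0
  leafError-H = cong ∣_∣ (trans (cong (λ k → + 3 ℤ.* - + Hₙ ℤ.- k ℤ.* + Hₙ) (classOf-negative H≥1))
                               (cancel (+ Hₙ)))
    where
    cancel : ∀ h → + 3 ℤ.* - h ℤ.- - + 3 ℤ.* h ≡ 0ℤ
    cancel = solve-∀

  leafError-h : ∣ leafError (+ hₙ) ∣ ≡ 3 * hₙ
  leafError-h = trans
    (cong ∣_∣ (trans (cong (λ k → + 3 ℤ.* + hₙ ℤ.- k ℤ.* + Hₙ) classOf-h) (drop (+ 3 ℤ.* + hₙ) (+ Hₙ))))
    (ℤP.∣i*j∣≡∣i∣*∣j∣ (+ 3) (+ hₙ))
    where
    drop : ∀ a h → a ℤ.- 0ℤ ℤ.* h ≡ a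
    drop = solve-∀

  leafError-a : ∀ i → ∣ leafError (+ aₙ i) ∣ ≤ 4 * K + hₙ
  leafError-a i = begin
    ∣ leafError (+ aₙ i) ∣                      ≡⟨ cong ∣_∣ leafError-a≡ ⟩
    ∣ + 3 ℤ.* + b i ℤ.- (+ K ℤ.+ + hₙ) ∣        ≤⟨ ℤP.∣i-j∣≤∣i∣+∣j∣ (+ 3 ℤ.* + b i) (+ K ℤ.+ + hₙ) ⟩
    ∣ + 3 ℤ.* + b i ∣ + (K + hₙ)                ≡⟨ cong (_+ (K + hₙ)) (ℤP.∣i*j∣≡∣i∣*∣j∣ (+ 3) (+ b i)) ⟩
    3 * b i + (K + hₙ)                          ≤⟨ ℕP.+-monoˡ-≤ (K + hₙ) (ℕP.*-monoʳ-≤ 3 (b≤K i)) ⟩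
    3 * K + (K + hₙ)                            ≡⟨ regroup K hₙ ⟩
    4 * K + hₙ                                  ∎
    where
    open ℕP.≤-Reasoning
    regroup : ∀ K h → 3 * K + (K + h) ≡ 4 * K + h
    regroup = ℕ-Solver.solve-∀
    cancel-W : ∀ b W K h → + 3 ℤ.* (b ℤ.+ W) ℤ.- + 1 ℤ.* (+ 3 ℤ.* W ℤ.+ K ℤ.+ h) ≡ + 3 ℤ.* b ℤ.- (K ℤ.+ h)
    cancel-W = solve-∀
    leafError-a≡ : leafError (+ aₙ i) ≡ + 3 ℤ.* + b i ℤ.- (+ K ℤ.+ + hₙ)
    leafError-a≡ = trans
      (cong₂ (λ k w → + 3 ℤ.* (+ b i ℤ.+ + Wₙ) ℤ.- k ℤ.* (w ℤ.+ + K ℤ.+ + hₙ)) (classOf-a i) (ℤP.pos-* 3 Wₙ))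
      (cancel-W (+ b i) (+ Wₙ) (+ K) (+ hₙ))

  sum-map-X : ∀ f → sum (map f X) ≡ sum (tabulate (f ∘ +_ ∘ aₙ)) + (m * f (- + Hₙ) + m * f (+ hₙ))
  sum-map-X f = begin
    sum (map f X)
      ≡⟨ cong sum (map-X f) ⟩
    sum (tabulate (f ∘ +_ ∘ aₙ) ++ (replicate m (f (- + Hₙ)) ++ replicate m (f (+ hₙ))))
      ≡⟨ ℕSum.sum-++ (tabulate (f ∘ +_ ∘ aₙ)) _ ⟩
    sum (tabulate (f ∘ +_ ∘ aₙ)) + sum (replicate m (f (- + Hₙ)) ++ replicate m (f (+ hₙ)))
      ≡⟨ cong (_+_ (sum (tabulate (f ∘ +_ ∘ aₙ)))) (trans (ℕSum.sum-++ (replicate m (f (- + Hₙ))) _)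
           (cong₂ _+_ (sum-replicate m (f (- + Hₙ))) (sum-replicate m (f (+ hₙ))))) ⟩
    sum (tabulate (f ∘ +_ ∘ aₙ)) + (m * f (- + Hₙ) + m * f (+ hₙ)) ∎
    where open ≡-Reasoning

  X-budget : sum (map (∣_∣ ∘ leafError) X) ≤ E
  X-budget = begin
    sum (map (∣_∣ ∘ leafError) X)
      ≡⟨ sum-map-X (∣_∣ ∘ leafError) ⟩
    sum (tabulate (∣_∣ ∘ leafError ∘ +_ ∘ aₙ)) + (m * ∣ leafError (- + Hₙ) ∣ + m * ∣ leafError (+ hₙ) ∣)
      ≤⟨ ℕP.+-mono-≤ (sum-tabulate-≤ (∣_∣ ∘ leafError ∘ +_ ∘ aₙ) leafError-a)
           (ℕP.≤-reflexive (cong₂ (λ x y → m * x + m * y) leafError-H leafError-h)) ⟩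
    3 * m * (4 * K + hₙ) + (m * 0 + m * (3 * hₙ))
      ≤⟨ ℕP.+-mono-≤ (ℕP.*-monoʳ-≤ (3 * m) (ℕP.+-monoʳ-≤ (4 * K) h≤4K))
           (ℕP.+-monoʳ-≤ (m * 0) (ℕP.*-monoʳ-≤ m (ℕP.*-monoʳ-≤ 3 h≤4K))) ⟩
    3 * m * (4 * K + 4 * K) + (m * 0 + m * (3 * (4 * K)))
      ≡⟨ total m K ⟩
    E ∎
    where
    open ℕP.≤-Reasoning
    total : ∀ m K → 3 * m * (4 * K + 4 * K) + (m * 0 + m * (3 * (4 * K))) ≡ 36 * m * K
    total = ℕ-Solver.solve-∀

  near⇒OfForm : ∀ {k z} → ∣ + 3 ℤ.* z ℤ.- k ℤ.* + Hₙ ∣ ≤ E → OfForm k z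
  near⇒OfForm {k} {z} near = begin
    ∣ + (1500 * m) ℤ.* z ℤ.- + (500 * m) ℤ.* k ℤ.* + Hₙ ∣  ≡⟨ cong ∣_∣ factor ⟩
    ∣ + (500 * m) ℤ.* (+ 3 ℤ.* z ℤ.- k ℤ.* + Hₙ) ∣         ≡⟨ ℤP.∣i*j∣≡∣i∣*∣j∣ (+ (500 * m)) _ ⟩
    500 * m * ∣ + 3 ℤ.* z ℤ.- k ℤ.* + Hₙ ∣                  ≤⟨ ℕP.*-monoʳ-≤ (500 * m) near ⟩
    500 * m * E                                              ≤⟨ 500mE≤3H ⟩
    3 * Hₙ                                                   ∎
    where
    open ℕP.≤-Reasoning
    1500m≡500m*3 : ∀ m → 1500 * m ≡ 500 * m * 3
    1500m≡500m*3 = ℕ-Solver.solve-∀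
    pull-out : ∀ c z k h → c ℤ.* + 3 ℤ.* z ℤ.- c ℤ.* k ℤ.* h ≡ c ℤ.* (+ 3 ℤ.* z ℤ.- k ℤ.* h)
    pull-out = solve-∀
    factor : + (1500 * m) ℤ.* z ℤ.- + (500 * m) ℤ.* k ℤ.* + Hₙ ≡ + (500 * m) ℤ.* (+ 3 ℤ.* z ℤ.- k ℤ.* + Hₙ)
    factor = trans (cong (λ c → c ℤ.* z ℤ.- + (500 * m) ℤ.* k ℤ.* + Hₙ)
                         (trans (cong +_ (1500m≡500m*3 m)) (ℤP.pos-* (500 * m) 3)))
                   (pull-out (+ (500 * m)) z k (+ Hₙ))

open import Data.Nat using (ℕ; _+_; _*_; _<_; _≤_)
open import Data.Integer as ℤ using (ℤ; +_; -_; +0)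

lemma2p7 : (m K : ℕ) → 1 ≤ m → 1 ≤ K → (b : Fin (3 * m) → ℕ)
    → (∀ i → 1 ≤ b i) → (∀ i → K < 4 * b i) → (∀ i → 2 * b i < K)
    → sum (tabulate b) ≡ m * K
    → (Tmin : Tree) → Setting.IsTreeOver m K b Tmin
    → (∀ T → Setting.IsTreeOver m K b T → cost Tmin ≤ cost T)
    → (∀ z → z ∈ nodes Tmin → +0 ℤ.< z
         → Setting.OfForm m K b (+ 0) z ⊎ Setting.OfForm m K b (+ 1) z ⊎ Setting.OfForm m K b (+ 2) z)
      × (∀ z → z ∈ internalNodes Tmin → z ℤ.< +0
         → Setting.OfForm m K b (+ 0) z ⊎ Setting.OfForm m K b (- (+ 1)) z ⊎ Setting.OfForm m K b (- (+ 2)) z)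
lemma2p7 m K m≥1 K≥1 b _ _ 2b<K _ Tmin Tmin-over Tmin-minimal =
    (λ z z∈ 0<z → Sum.map near⇒OfForm (Sum.map near⇒OfForm near⇒OfForm) (positive-node z∈ 0<z))
  , (λ z z∈ z<0 → Sum.map near⇒OfForm (Sum.map near⇒OfForm near⇒OfForm) (negative-internal-node z∈ z<0))
  where
  b≤K : ∀ i → b i ≤ K
  b≤K i = ℕP.≤-trans (ℕP.m≤m+n (b i) (b i + 0)) (ℕP.<⇒≤ (2b<K i))

  open Setting m K b using (X)
  open Reduction m K b m≥1 K≥1 b≤K
  open MinimumCost classOf-range X X-balanced E X-budget 2E<H Tmin Tmin-over Tmin-minimal
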